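{- Let $\varepsilon_0 \in \{\pm 1\}$ and let $A$ be a set of prime powers with $|A| \ge 3$ such that, whenever $q$ is a prime dividing $\prod_{a \in B} a - \varepsilon_0$ for some $B \in \mathcal P_\star(A)$, $q$ divides some element of $A$. Then $A$ is infinite. Moreover, if $\varepsilon_0 = 1$, then every prime divides some element of $A$. Finally, if $A$ consists of primes only (i.e. $A \subseteq \mathbb P$), then $A = \mathbb P$.
   Context: $\mathbb P$ denotes the set of all positive rational primes. A prime power is a number of the form $p^k$ with $p$ prime and $k \ge 1$ (so $1$ is not a prime power). For a set $X$, $\mathcal P_\star(X)$ denotes the family of all finite nonempty proper subsets of $X$. -}

module Defs where

open import Level using (0ℓ)
open import Data.Nat using (ℕ; _≤_; _^_)
open import Data.Nat.Primality using (Prime)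
open import Data.Nat.Divisibility using () renaming (_∣_ to _∣ℕ_)
open import Data.Integer using (ℤ; +_; _-_; 1ℤ; -1ℤ)
open import Data.Integer.Divisibility using () renaming (_∣_ to _∣ℤ_)
open import Data.List using (List; [])
open import Data.Nat.ListAction using (product)
open import Data.List.Membership.Propositional using (_∈_; _∉_)
open import Data.List.Relation.Unary.All using (All)
open import Data.List.Relation.Unary.Unique.Propositional using (Unique)
open import Data.Product using (Σ; ∃; ∃-syntax; _×_)
open import Relation.Binary.PropositionalEquality using (_≡_; _≢_)
open import Relation.Nullary using (¬_)

Subset : Set₁
Subset = ℕ → Set

IsPrimePower : ℕ → Set
IsPrimePower n = ∃[ p ] ∃[ k ] (Prime p × 1 ≤ k × n ≡ p ^ k)

Finite : Subset → Set
Finite A = ∃[ xs ] (∀ a → A a → a ∈ xs)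

Infinite : Subset → Set
Infinite A = ¬ Finite A

AtLeast3 : Subset → Set
AtLeast3 A = ∃[ a ] ∃[ b ] ∃[ c ]
  (A a × A b × A c × a ≢ b × a ≢ c × b ≢ c)

-- B ∈ 𝒫⋆(A): a finite nonempty proper subset of A, given as a
-- duplicate-free list of its elements.
InPStar : Subset → List ℕ → Set
InPStar A B = Unique B × B ≢ [] × All A B × ∃[ a ] (A a × a ∉ B)

Hyp : ℤ → Subset → Set
Hyp ε A = ∀ (B : List ℕ) → InPStar A B → ∀ q → Prime q →
  (+ q) ∣ℤ (+ product B - ε) → ∃[ a ] (A a × q ∣ℕ a)

-- The number ∏B - ε₀ is handled in ℕ as `shift s (∏ B)`.
-- A prime factor of it is coprime to ∏B, so it divides an element OUTSIDE B.
--
-- (1) If A were finite, list it as a < b < c < rest and let R = c·∏rest.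
--     Leaving out a, b, or both shows: bR - ε₀ is a power of the prime pa of a,
--     aR - ε₀ one of pb, and R - ε₀ = pa^u·pb^v; comparing gives pa^u ∣ b - 1 and
--     pb^v ∣ a - 1, so R - ε₀ ≤ (a-1)(b-1).  A fourth element makes R too big;
--     with exactly three, a, b, c divide each other's shifted products, so
--     abc ∣ ab + bc + ca - ε₀, which is too small.
-- (2) For ε₀ = 1, if p divides no element, the partial products of distinct
--     x₀, x₁, … ∈ A repeat a residue mod p, giving p ∣ xᵢ⋯xⱼ₋₁ - 1.
-- (3) For ε₀ = -1 and a prime p ∉ A ⊆ ℙ, let E ⊂ A be finite, containing all
--     elements of the residue classes mod p that meet A finitely, e = ∏E and
--     t₀ = 1, tₖ₊₁ = e tₖ + 1.  Every tₖ is ≡ a product of fresh elements of A,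
--     since prime factors of ∏(E ∪ B) + 1 lie in infinite classes; pigeonhole
--     gives p ∣ tₖ₊₁ ≡ ∏(E ∪ B) + 1, a contradiction.

module Submission where

open import Defs
open import Level using (0ℓ)
open import Axiom.ExcludedMiddle using (ExcludedMiddle)
open import Axiom.DoubleNegationElimination using (em⇒dne)
open import Data.Nat using (ℕ; zero; suc; _+_; _*_; _∸_; _^_; _≤_; _<_; z≤n; s≤s; NonZero; >-nonZero; nonTrivial⇒n>1; _%_; _/_)
open import Data.Nat.Properties
open import Data.Nat.Primality using (Prime; euclidsLemma; prime⇒irreducible; prime⇒nonZero; prime⇒nonTrivial; ¬prime[1])
open import Data.Nat.Primality.Factorisation using (factorise)
open import Data.Nat.Divisibility using (_∣_; divides; ∣m+n∣m⇒∣n; ∣m∣n⇒∣m+n; ∣-trans; ∣1⇒≡1; ∣⇒≤; ∣n⇒∣m*n; ∣m⇒∣m*n; n∣m*n; m∣m*n; m%n≡0⇒n∣m; n∣m⇒m%n≡0)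
open import Data.Nat.Coprimality using (Coprime; coprime-divisor)
open import Data.Nat.DivMod using (m≡m%n+[m/n]*n; %-distribˡ-*; %-distribˡ-+; m%n<n)
open import Data.Nat.ListAction using (product; sum)
open import Data.Nat.ListAction.Properties using (∈⇒∣product; product-++)
open import Data.Nat.Solver using (module +-*-Solver)
open +-*-Solver using (solve; _:+_; _:*_; _:=_; con)
open import Data.Integer using (ℤ; +_; _-_; 1ℤ; -1ℤ)
open import Data.Integer.Divisibility using () renaming (_∣_ to _∣ℤ_)
open import Data.Fin using (Fin; toℕ; fromℕ<)
import Data.Fin.Properties as Fin
open import Data.List using (List; []; _∷_; _++_; filter; upTo)
open import Data.List.Membership.Propositional using (_∈_; _∉_)
open import Data.List.Membership.Propositional.Properties using (∈-filter⁺; ∈-filter⁻; ∈-upTo⁺; ∈-++⁺ˡ; ∈-++⁺ʳ)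
open import Data.List.Relation.Unary.All as All using (All; []; _∷_)
import Data.List.Relation.Unary.All.Properties as All
open import Data.List.Relation.Unary.Any using (here; there)
open import Data.List.Relation.Unary.AllPairs as AllPairs using (AllPairs; []; _∷_)
import Data.List.Relation.Unary.AllPairs.Properties as AllPairs
open import Data.List.Relation.Unary.Unique.Propositional using (Unique)
import Data.List.Relation.Unary.Unique.Propositional.Properties as Unique
open import Data.Product using (∃₂; ∃-syntax; _×_; _,_; proj₁; proj₂)
open import Data.Sum using (_⊎_; inj₁; inj₂; [_,_]′)
open import Data.Empty using (⊥; ⊥-elim)
open import Relation.Nullary using (¬_; Dec; yes; no)
open import Relation.Binary.PropositionalEquality using (_≡_; _≢_; refl; sym; trans; cong; cong₂; subst; module ≡-Reasoning)

data Sign : Set where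
  plus minus : Sign

value : Sign → ℤ
value plus  = 1ℤ
value minus = -1ℤ

sign-of : ∀ {ε} → ε ≡ 1ℤ ⊎ ε ≡ -1ℤ → ∃[ s ] (ε ≡ value s)
sign-of (inj₁ ε≡1) = plus , ε≡1
sign-of (inj₂ ε≡-1) = minus , ε≡-1

-- shift s P is P - ε₀ as a natural number (for P ≥ 1).
shift : Sign → ℕ → ℕ
shift plus  P = P ∸ 1
shift minus P = P + 1

shift-∣ℤ : ∀ s {P q} → 1 ≤ P → q ∣ shift s P → (+ q) ∣ℤ (+ P - value s)
shift-∣ℤ plus  {suc P} _ q∣P = q∣P
shift-∣ℤ minus         _ q∣P+1 = q∣P+1

shift-+ : ∀ s x {y} → 1 ≤ y → shift s (x + y) ≡ x + shift s y
shift-+ plus  x {suc y} _ = cong (_∸ 1) (+-suc x y)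
shift-+ minus x {y}     _ = +-assoc x y 1

shift-≥ : ∀ s P → P ∸ 1 ≤ shift s P
shift-≥ plus  P = ≤-refl
shift-≥ minus P = ≤-trans (m∸n≤m P 1) (m≤m+n P 1)

shift-≤ : ∀ s P → shift s P ≤ P + 1
shift-≤ plus  P = ≤-trans (m∸n≤m P 1) (m≤m+n P 1)
shift-≤ minus P = ≤-refl

≤shift+1 : ∀ s P → P ≤ shift s P + 1
≤shift+1 plus  zero    = z≤n
≤shift+1 plus  (suc P) = ≤-reflexive (+-comm 1 P)
≤shift+1 minus P       = ≤-trans (m≤m+n P 2) (≤-reflexive (sym (+-assoc P 1 1)))

shift-mono : ∀ s {P Q} → P ≤ Q → shift s P ≤ shift s Q
shift-mono plus  P≤Q = ∸-monoˡ-≤ 1 P≤Q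
shift-mono minus P≤Q = +-monoˡ-≤ 1 P≤Q

shift-positive : ∀ s {P} → 2 ≤ P → 1 ≤ shift s P
shift-positive s {P} 2≤P = ≤-trans (∸-monoˡ-≤ 1 2≤P) (shift-≥ s P)

≤shift-* : ∀ s {x} y → 2 ≤ x → y ≤ shift s (x * y)
≤shift-* s zero    _   = z≤n
≤shift-* s {x} (suc y) 2≤x = begin
  suc y                   ≤⟨ m≤m+n (suc y) y ⟩
  suc (y + y)             ≡⟨ solve 1 (λ y → con 1 :+ (y :+ y) := y :+ (con 1 :+ (y :+ con 0))) refl y ⟩
  2 * suc y ∸ 1           ≤⟨ ∸-monoˡ-≤ 1 (*-monoˡ-≤ (suc y) 2≤x) ⟩
  x * suc y ∸ 1           ≤⟨ shift-≥ s (x * suc y) ⟩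
  shift s (x * suc y)     ∎
  where open ≤-Reasoning

shift-coprime : ∀ s {P d} → 1 ≤ P → d ∣ P → d ∣ shift s P → d ∣ 1
shift-coprime plus  {suc P} {d} _ d∣P d∣P-1 = ∣m+n∣m⇒∣n (subst (d ∣_) (+-comm 1 P) d∣P) d∣P-1
shift-coprime minus             _ d∣P d∣P+1 = ∣m+n∣m⇒∣n d∣P+1 d∣P

-- bR - ε₀ = b (R - ε₀) + ε₀ (b - 1), so a common divisor of R - ε₀ and
-- bR - ε₀ divides b - 1.
shift-* : ∀ s {b R d} → 1 ≤ b → 1 ≤ R → d ∣ shift s R → d ∣ shift s (b * R) → d ∣ b ∸ 1
shift-* plus {suc b} {suc R} {d} _ _ d∣R-1 d∣bR-1 =
  ∣m+n∣m⇒∣n (subst (d ∣_) split d∣bR-1) (∣n⇒∣m*n (suc b) d∣R-1)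
  where
    split : suc b * suc R ∸ 1 ≡ suc b * R + b
    split = solve 2 (λ b R → R :+ b :* (con 1 :+ R) := (con 1 :+ b) :* R :+ b) refl b R
shift-* minus {suc b} {R} {d} _ _ d∣R+1 d∣bR+1 =
  ∣m+n∣m⇒∣n (subst (d ∣_) split (∣n⇒∣m*n (suc b) d∣R+1)) d∣bR+1
  where
    split : suc b * (R + 1) ≡ (suc b * R + 1) + b
    split = solve 2 (λ b R → (con 1 :+ b) :* (R :+ con 1) := ((con 1 :+ b) :* R :+ con 1) :+ b) refl b R

-- Primes and prime powers.

prime∤1 : ∀ {p} → Prime p → ¬ p ∣ 1
prime∤1 pp p∣1 with ∣1⇒≡1 p∣1
... | refl = ¬prime[1] pp

prime≥2 : ∀ {p} → Prime p → 2 ≤ p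
prime≥2 {p} pp = nonTrivial⇒n>1 p {{prime⇒nonTrivial pp}}

prime∣prime⇒≡ : ∀ {q p} → Prime q → Prime p → q ∣ p → q ≡ p
prime∣prime⇒≡ pq pp q∣p with prime⇒irreducible pp q∣p
... | inj₁ refl = ⊥-elim (¬prime[1] pq)
... | inj₂ q≡p  = q≡p

prime∣^⇒∣ : ∀ {p} m k → Prime p → p ∣ m ^ k → p ∣ m
prime∣^⇒∣ m zero    pp p∣1 = ⊥-elim (prime∤1 pp p∣1)
prime∣^⇒∣ m (suc k) pp p∣mᵏ⁺¹ with euclidsLemma m (m ^ k) pp p∣mᵏ⁺¹
... | inj₁ p∣m  = p∣m
... | inj₂ p∣mᵏ = prime∣^⇒∣ m k pp p∣mᵏ

prime∤product : ∀ {p} xs → Prime p → All (λ x → ¬ p ∣ x) xs → ¬ p ∣ product xs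
prime∤product []       pp []         p∣1 = prime∤1 pp p∣1
prime∤product (x ∷ xs) pp (p∤x ∷ p∤xs) p∣xxs with euclidsLemma x (product xs) pp p∣xxs
... | inj₁ p∣x  = p∤x p∣x
... | inj₂ p∣xs = prime∤product xs pp p∤xs p∣xs

product≥1 : ∀ xs → All (1 ≤_) xs → 1 ≤ product xs
product≥1 []       []           = ≤-refl
product≥1 (x ∷ xs) (1≤x ∷ 1≤xs) = *-mono-≤ 1≤x (product≥1 xs 1≤xs)

2≤* : ∀ {x y} → 2 ≤ x → 2 ≤ y → 2 ≤ x * y
2≤* {x} {y} 2≤x 2≤y = ≤-trans 2≤y (m≤n*m y x {{>-nonZero (≤-trans (s≤s z≤n) 2≤x)}})

base : ∀ {a} → IsPrimePower a → ℕ
base = proj₁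

base-prime : ∀ {a} (h : IsPrimePower a) → Prime (base h)
base-prime (_ , _ , pp , _) = pp

prime∣primePower⇒≡base : ∀ {a q} (h : IsPrimePower a) → Prime q → q ∣ a → q ≡ base h
prime∣primePower⇒≡base (p , k , pp , _ , refl) pq q∣pᵏ = prime∣prime⇒≡ pq pp (prime∣^⇒∣ p k pq q∣pᵏ)

primePower≥2 : ∀ {a} → IsPrimePower a → 2 ≤ a
primePower≥2 (p , suc k , pp , _ , refl) =
  ≤-trans (prime≥2 pp) (m≤m*n p (p ^ k) {{m^n≢0 p k {{prime⇒nonZero pp}}}})

OnlyPrimeFactor : ℕ → ℕ → Set
OnlyPrimeFactor p m = ∀ r → Prime r → r ∣ m → r ≡ p

two-prime-support : ∀ {m} p q → 1 ≤ m → (∀ r → Prime r → r ∣ m → r ≡ p ⊎ r ≡ q) →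
                    ∃₂ λ u v → m ≡ p ^ u * q ^ v
two-prime-support {suc m} p q _ support with factorise (suc m)
... | record { factors = fs ; isFactorisation = m≡∏fs ; factorsPrime = fs-prime }
  with collect fs (All.tabulate λ {r} r∈fs →
         support r (All.lookup fs-prime r∈fs) (subst (r ∣_) (sym m≡∏fs) (∈⇒∣product r∈fs)))
  where
    collect : ∀ fs → All (λ r → r ≡ p ⊎ r ≡ q) fs → ∃₂ λ u v → product fs ≡ p ^ u * q ^ v
    collect []       []       = 0 , 0 , refl
    collect (f ∷ fs) (f≡ ∷ fs≡) with collect fs fs≡ | f≡
    ... | u , v , ∏fs≡ | inj₁ refl =
      suc u , v , trans (cong (f *_) ∏fs≡) (sym (*-assoc f (f ^ u) (q ^ v)))
    ... | u , v , ∏fs≡ | inj₂ refl =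
      u , suc v , trans (cong (f *_) ∏fs≡)
                        (solve 3 (λ f a b → f :* (a :* b) := a :* (f :* b)) refl f (p ^ u) (f ^ v))
... | u , v , ∏fs≡ = u , v , trans m≡∏fs ∏fs≡

power-≤⇒∣ : ∀ {p} f k → 2 ≤ p → p ^ f ≤ p ^ k → p ^ f ∣ p ^ k
power-≤⇒∣ {p} f k 2≤p pᶠ≤pᵏ with f ≤? k
... | yes f≤k = divides (p ^ (k ∸ f))
                  (trans (cong (p ^_) (sym (m∸n+n≡m f≤k))) (^-distribˡ-+-* p (k ∸ f) f))
... | no  f≰k = ⊥-elim (<⇒≱ (^-monoʳ-< p 2≤p (≰⇒> f≰k)) pᶠ≤pᵏ)

onlyPrimeFactor-≤⇒∣ : ∀ {p m} f → 2 ≤ p → 1 ≤ m → OnlyPrimeFactor p m → p ^ f ≤ m → p ^ f ∣ m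
onlyPrimeFactor-≤⇒∣ {p} f 2≤p 1≤m only pᶠ≤m
  with two-prime-support p p 1≤m (λ r pr r∣m → inj₁ (only r pr r∣m))
... | u , v , refl rewrite sym (^-distribˡ-+-* p u v) = power-≤⇒∣ f (u + v) 2≤p pᶠ≤m

primePower-≤⇒∣ : ∀ {a m} (h : IsPrimePower a) → 1 ≤ m → OnlyPrimeFactor (base h) m → a ≤ m → a ∣ m
primePower-≤⇒∣ (p , k , pp , _ , refl) 1≤m only a≤m = onlyPrimeFactor-≤⇒∣ k (prime≥2 pp) 1≤m only a≤m

power∣pred : ∀ s {p b R} u → Prime p → 2 ≤ b → 2 ≤ R →
             OnlyPrimeFactor p (shift s (b * R)) → p ^ u ∣ shift s R → p ^ u ∣ b ∸ 1
power∣pred s {p} {b} {R} u pp 2≤b 2≤R only pᵘ∣ =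
  shift-* s (≤-trans (s≤s z≤n) 2≤b) (≤-trans (s≤s z≤n) 2≤R) pᵘ∣
    (onlyPrimeFactor-≤⇒∣ u (prime≥2 pp) (shift-positive s (2≤* 2≤b 2≤R)) only pᵘ≤)
  where
    pᵘ≤ : p ^ u ≤ shift s (b * R)
    pᵘ≤ = ≤-trans (∣⇒≤ {{>-nonZero (shift-positive s 2≤R)}} pᵘ∣)
                  (shift-mono s (m≤n*m R b {{>-nonZero (≤-trans (s≤s z≤n) 2≤b)}}))

-- Residues modulo p.

≡-mod⇒∣ : ∀ m x p .{{_ : NonZero p}} → (m + x) % p ≡ m % p → p ∣ x
≡-mod⇒∣ m x p same = ∣m+n∣m⇒∣n (subst (p ∣_) multiples (n∣m*n ((m + x) / p))) (n∣m*n (m / p))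
  where
    open ≡-Reasoning
    multiples : (m + x) / p * p ≡ m / p * p + x
    multiples = +-cancelˡ-≡ (m % p) _ _ (begin
      m % p + (m + x) / p * p        ≡⟨ cong (_+ (m + x) / p * p) (sym same) ⟩
      (m + x) % p + (m + x) / p * p  ≡⟨ sym (m≡m%n+[m/n]*n (m + x) p) ⟩
      m + x                          ≡⟨ cong (_+ x) (m≡m%n+[m/n]*n m p) ⟩
      m % p + m / p * p + x          ≡⟨ +-assoc (m % p) _ x ⟩
      m % p + (m / p * p + x)        ∎)

cancel-mod : ∀ {p} .{{_ : NonZero p}} m Q → Prime p → ¬ p ∣ m → 1 ≤ Q →
             (Q * m) % p ≡ m % p → p ∣ Q ∸ 1
cancel-mod {p} m Q pp p∤m 1≤Q same
  with euclidsLemma (Q ∸ 1) m pp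
         (≡-mod⇒∣ m ((Q ∸ 1) * m) p (trans (cong (_% p) Qm≡) same))
  where
    Qm≡ : m + (Q ∸ 1) * m ≡ Q * m
    Qm≡ = cong (_* m) (m+[n∸m]≡n 1≤Q)
... | inj₁ p∣Q-1 = p∣Q-1
... | inj₂ p∣m   = ⊥-elim (p∤m p∣m)

*-cong-mod : ∀ {p} .{{_ : NonZero p}} a b c d → a % p ≡ b % p → c % p ≡ d % p → (a * c) % p ≡ (b * d) % p
*-cong-mod {p} a b c d a≡b c≡d =
  trans (%-distribˡ-* a c p) (trans (cong₂ (λ u v → (u * v) % p) a≡b c≡d) (sym (%-distribˡ-* b d p)))

+-cong-mod : ∀ {p} .{{_ : NonZero p}} a b c → a % p ≡ b % p → (a + c) % p ≡ (b + c) % p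
+-cong-mod {p} a b c a≡b =
  trans (%-distribˡ-+ a c p) (trans (cong (λ u → (u + c % p) % p) a≡b) (sym (%-distribˡ-+ b c p)))

residue-collision : ∀ p .{{_ : NonZero p}} (f : ℕ → ℕ) → ∃₂ λ i d → f (suc d + i) % p ≡ f i % p
residue-collision p f with Fin.pigeonhole (n<1+n p) residue
  where
    residue : Fin (suc p) → Fin p
    residue k = fromℕ< (m%n<n (f (toℕ k)) p)
... | i , j , i<j , same = toℕ i , toℕ j ∸ suc (toℕ i) , (begin
  f (suc (toℕ j ∸ suc (toℕ i) + toℕ i)) % p  ≡⟨ cong (λ n → f n % p) index ⟩
  f (toℕ j) % p                               ≡⟨ sym (residue≡ j) ⟩
  toℕ (fromℕ< (m%n<n (f (toℕ j)) p))          ≡⟨ cong toℕ (sym same) ⟩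
  toℕ (fromℕ< (m%n<n (f (toℕ i)) p))          ≡⟨ residue≡ i ⟩
  f (toℕ i) % p                               ∎)
  where
    open ≡-Reasoning
    residue≡ : ∀ k → toℕ (fromℕ< (m%n<n (f (toℕ k)) p)) ≡ f (toℕ k) % p
    residue≡ k = Fin.toℕ-fromℕ< (m%n<n (f (toℕ k)) p)
    index : suc (toℕ j ∸ suc (toℕ i) + toℕ i) ≡ toℕ j
    index = trans (sym (+-suc (toℕ j ∸ suc (toℕ i)) (toℕ i))) (m∸n+n≡m i<j)

∈⇒≤sum : ∀ {x xs} → x ∈ xs → x ≤ sum xs
∈⇒≤sum {x} {_ ∷ xs} (here refl) = m≤m+n x (sum xs)
∈⇒≤sum {x} {y ∷ xs} (there x∈xs) = ≤-trans (∈⇒≤sum x∈xs) (m≤n+m (sum xs) y)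

module Classical (em : ExcludedMiddle 0ℓ) where

  dne : {P : Set} → ¬ ¬ P → P
  dne = em⇒dne em

  enumerate : (P : ℕ → Set) (xs : List ℕ) → (∀ x → P x → x ∈ xs) →
              ∃[ L ] (AllPairs _<_ L × All P L × (∀ x → P x → x ∈ L))
  enumerate P xs bounded = filter P? (upTo K) , increasing , All.tabulate satisfies , complete
    where
      P? : (x : ℕ) → Dec (P x)
      P? x = em
      K : ℕ
      K = suc (sum xs)
      increasing : AllPairs _<_ (filter P? (upTo K))
      increasing = AllPairs.filter⁺ P? (AllPairs.applyUpTo⁺₁ (λ i → i) K (λ i<j _ → i<j))
      satisfies : ∀ {x} → x ∈ filter P? (upTo K) → P x
      satisfies x∈ = proj₂ (∈-filter⁻ P? {xs = upTo K} x∈)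
      complete : ∀ x → P x → x ∈ filter P? (upTo K)
      complete x Px = ∈-filter⁺ P? (∈-upTo⁺ (s≤s (∈⇒≤sum (bounded x Px)))) Px

  fresh : ∀ {A : Subset} → Infinite A → ∀ F → ∃[ a ] (A a × a ∉ F)
  fresh inf F = dne λ none → inf (F , λ a Aa → dne λ a∉F → none (a , Aa , a∉F))

ShiftHyp : Sign → Subset → Set
ShiftHyp s A = ∀ B → InPStar A B → ∀ q → Prime q → q ∣ shift s (product B) → ∃[ a ] (A a × q ∣ a)

primePowers-product≥1 : ∀ {A : Subset} → (∀ a → A a → IsPrimePower a) → ∀ {B} → All A B → 1 ≤ product B
primePowers-product≥1 ppA {B} allA =
  product≥1 B (All.map (λ {a} Aa → ≤-trans (s≤s z≤n) (primePower≥2 (ppA a Aa))) allA)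

Hyp⇒ShiftHyp : ∀ s {A} → (∀ a → A a → IsPrimePower a) → Hyp (value s) A → ShiftHyp s A
Hyp⇒ShiftHyp s ppA hyp B B∈ q pq q∣ =
  hyp B B∈ q pq (shift-∣ℤ s (primePowers-product≥1 ppA (proj₁ (proj₂ (proj₂ B∈)))) q∣)

<-∉ : ∀ {x ys} → All (x <_) ys → x ∉ ys
<-∉ (x<y ∷ _)   (here refl) = n≮n _ x<y
<-∉ (_ ∷ x<ys) (there x∈ys) = <-∉ x<ys x∈ys

increasing⇒InPStar : ∀ {A : Subset} {B m} → AllPairs _<_ B → B ≢ [] → All A B → A m → m ∉ B → InPStar A B
increasing⇒InPStar increasing nonempty allA Am m∉B =
  AllPairs.map <⇒≢ increasing , nonempty , allA , _ , Am , m∉B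

-- A prime factor of ∏B - ε₀ divides an element of A outside B (inside B it would divide ∏B).
factor-outside : ∀ s {A} → (∀ a → A a → IsPrimePower a) → ShiftHyp s A →
                 ∀ {B q} → InPStar A B → Prime q → q ∣ shift s (product B) → ∃[ w ] (A w × w ∉ B × q ∣ w)
factor-outside s ppA hyp {B} {q} B∈ pq q∣ with hyp B B∈ q pq q∣
... | w , Aw , q∣w = w , Aw , w∉B , q∣w
  where
    w∉B : w ∉ B
    w∉B w∈B = prime∤1 pq (shift-coprime s (primePowers-product≥1 ppA (proj₁ (proj₂ (proj₂ B∈))))
                                         (∣-trans q∣w (∈⇒∣product w∈B)) q∣)

-- Arithmetic behind the finiteness contradiction.

coprime-∣⇒*∣ : ∀ {m n x} → Coprime m n → m ∣ x → n ∣ x → m * n ∣ x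
coprime-∣⇒*∣ {m} {n} m⊥n m∣x (divides k refl) with coprime-divisor m⊥n (subst (m ∣_) (*-comm k n) m∣x)
... | divides j refl = divides j (*-assoc j m n)

-- If a, b, c ≥ 2 each divide the shifted product of the other two, they are
-- pairwise coprime divisors of ab + bc + ca - ε₀, hence so is abc.
pairwise⇒abc∣ : ∀ s {a b c} → 2 ≤ a → 2 ≤ b → 2 ≤ c →
                a ∣ shift s (b * c) → b ∣ shift s (a * c) → c ∣ shift s (a * b) →
                a * b * c ∣ shift s (a * (b + c) + b * c)
pairwise⇒abc∣ s {a} {b} {c} 2≤a 2≤b 2≤c a∣ b∣ c∣ =
  subst (_∣ S) (*-comm c (a * b)) (coprime-∣⇒*∣ c⊥ab c∣S (coprime-∣⇒*∣ a⊥b a∣S b∣S))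
  where
    S : ℕ
    S = shift s (a * (b + c) + b * c)
    positive : ∀ {x y} → 2 ≤ x → 2 ≤ y → 1 ≤ x * y
    positive 2≤x 2≤y = *-mono-≤ (≤-trans (s≤s z≤n) 2≤x) (≤-trans (s≤s z≤n) 2≤y)
    -- S = x (y + z) + (yz - ε₀) for every arrangement x, y, z of a, b, c.
    divides-S : ∀ x {y z} → x * (y + z) + y * z ≡ a * (b + c) + b * c →
                2 ≤ y → 2 ≤ z → x ∣ shift s (y * z) → x ∣ S
    divides-S x {y} {z} same 2≤y 2≤z x∣ =
      subst (λ n → x ∣ shift s n) same
        (subst (x ∣_) (sym (shift-+ s (x * (y + z)) (positive 2≤y 2≤z))) (∣m∣n⇒∣m+n (m∣m*n (y + z)) x∣))
    a∣S : a ∣ S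
    a∣S = divides-S a refl 2≤b 2≤c a∣
    b∣S : b ∣ S
    b∣S = divides-S b (solve 3 (λ a b c → b :* (a :+ c) :+ a :* c := a :* (b :+ c) :+ b :* c) refl a b c) 2≤a 2≤c b∣
    c∣S : c ∣ S
    c∣S = divides-S c (solve 3 (λ a b c → c :* (a :+ b) :+ a :* b := a :* (b :+ c) :+ b :* c) refl a b c) 2≤a 2≤b c∣
    a⊥b : Coprime a b
    a⊥b (d∣a , d∣b) = ∣1⇒≡1 (shift-coprime s (positive 2≤b 2≤c) (∣m⇒∣m*n c d∣b) (∣-trans d∣a a∣))
    c⊥ab : Coprime c (a * b)
    c⊥ab (d∣c , d∣ab) = ∣1⇒≡1 (shift-coprime s (positive 2≤a 2≤b) d∣ab (∣-trans d∣c c∣))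

square-bound : ∀ e → 2 ≤ e → ¬ (suc (suc e) * suc (suc e) ≤ e * suc e + 1 + 2 * suc (suc e))
square-bound (suc zero)    (s≤s ())
square-bound (suc (suc m)) _ le = m+1+n≰m rhs (≤-trans (≤-reflexive expand) le)
  where
    rhs : ℕ
    rhs = suc (suc m) * suc (suc (suc m)) + 1 + 2 * suc (suc (suc (suc m)))
    expand : rhs + suc m ≡ suc (suc (suc (suc m))) * suc (suc (suc (suc m)))
    expand = solve 1 (λ m → ((con 2 :+ m) :* (con 3 :+ m) :+ con 1 :+ con 2 :* (con 4 :+ m)) :+ (con 1 :+ m)
                            := (con 4 :+ m) :* (con 4 :+ m)) refl m

-- There are no 2 ≤ a < b < c with c ≤ (a - 1)(b - 1) + 1 and abc ≤ ab + bc + ca + 1: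
-- the two bounds combine to c² ≤ ab + 1 + 2c, impossible as a ≤ c - 2 and b ≤ c - 1.
abc-too-large : ∀ {a b c} → 2 ≤ a → a < b → b < c → c ≤ (b ∸ 1) * (a ∸ 1) + 1 →
                ¬ (a * b * c ≤ a * (b + c) + b * c + 1)
abc-too-large {b = suc _} {c = suc zero} _ _ (s≤s ()) _ _
abc-too-large {suc a′} {suc b′} {suc (suc e)} 2≤a a<b b<c c≤ abc≤ =
  square-bound e 2≤e (≤-trans c²≤ (+-monoˡ-≤ (2 * c) (+-monoˡ-≤ 1 (*-mono-≤ a≤e b≤e+1))))
  where
    a b c : ℕ
    a = suc a′
    b = suc b′
    c = suc (suc e)
    open ≤-Reasoning
    c²≤ : c * c ≤ a * b + 1 + 2 * c
    c²≤ = +-cancelʳ-≤ (c * (a + b)) _ _ (begin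
      c * c + c * (a + b)              ≤⟨ +-monoˡ-≤ (c * (a + b)) (*-monoʳ-≤ c c≤) ⟩
      c * (b′ * a′ + 1) + c * (a + b)  ≡⟨ solve 3 (λ a′ b′ c → c :* (b′ :* a′ :+ con 1) :+ c :* ((con 1 :+ a′) :+ (con 1 :+ b′))
                                                  := (con 1 :+ a′) :* (con 1 :+ b′) :* c :+ con 2 :* c) refl a′ b′ c ⟩
      a * b * c + 2 * c                ≤⟨ +-monoˡ-≤ (2 * c) abc≤ ⟩
      a * (b + c) + b * c + 1 + 2 * c  ≡⟨ solve 3 (λ a b c → a :* (b :+ c) :+ b :* c :+ con 1 :+ con 2 :* c
                                                  := (a :* b :+ con 1 :+ con 2 :* c) :+ c :* (a :+ b)) refl a b c ⟩
      a * b + 1 + 2 * c + c * (a + b)  ∎)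
    a≤e : a ≤ e
    a≤e = ≤-pred (≤-pred (≤-trans (s≤s a<b) b<c))
    b≤e+1 : b ≤ suc e
    b≤e+1 = ≤-pred b<c
    2≤e : 2 ≤ e
    2≤e = ≤-trans 2≤a a≤e

pred-product-bound : ∀ {a b} → 2 ≤ a → 3 ≤ b → (b ∸ 1) * (a ∸ 1) + 1 ≤ a * b ∸ 1
pred-product-bound {b = suc zero} _ (s≤s ())
pred-product-bound {suc a′} {suc (suc b″)} _ _ =
  ≤-trans (m≤m+n _ (b″ + a′))
    (≤-reflexive (solve 2 (λ a′ b″ → (con 1 :+ b″) :* a′ :+ con 1 :+ (b″ :+ a′)
                                      := (con 1 :+ b″) :+ a′ :* (con 2 :+ b″)) refl a′ b″))

product-too-large : ∀ {a b c d P} → a < b → b < c → b < d → 1 ≤ P → ¬ (c * (d * P) ≤ (b ∸ 1) * (a ∸ 1) + 1)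
product-too-large {a} {suc b′} {c} {d} {P} a<b b<c b<d 1≤P cdP≤ =
  m+1+n≰m (b′ * b′ + 1) (≤-trans (≤-reflexive expand) (begin
    suc (suc b′) * suc (suc b′)  ≤⟨ *-mono-≤ b<c b<d ⟩
    c * d                        ≤⟨ *-monoʳ-≤ c (m≤m*n d P {{>-nonZero 1≤P}}) ⟩
    c * (d * P)                  ≤⟨ cdP≤ ⟩
    b′ * (a ∸ 1) + 1             ≤⟨ +-monoˡ-≤ 1 (*-monoʳ-≤ b′ (∸-monoˡ-≤ 1 (<⇒≤ a<b))) ⟩
    b′ * b′ + 1                  ∎))
  where
    open ≤-Reasoning
    expand : b′ * b′ + 1 + suc (4 * b′ + 2) ≡ suc (suc b′) * suc (suc b′)
    expand = solve 1 (λ b′ → b′ :* b′ :+ con 1 :+ (con 1 :+ (con 4 :* b′ :+ con 2)) := (con 2 :+ b′) :* (con 2 :+ b′)) refl b′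

three-members : ∀ {x y z : ℕ} L → x ∈ L → y ∈ L → z ∈ L → x ≢ y → x ≢ z → y ≢ z →
                ∃[ a ] ∃[ b ] ∃[ c ] ∃[ rest ] (L ≡ a ∷ b ∷ c ∷ rest)
three-members (_ ∷ []) (here refl) (here refl) _ x≢y _ _ = ⊥-elim (x≢y refl)
three-members (_ ∷ _ ∷ []) x∈ y∈ z∈ x≢y x≢z y≢z with x∈ | y∈ | z∈
... | here refl         | here refl         | _                 = ⊥-elim (x≢y refl)
... | here refl         | _                 | here refl         = ⊥-elim (x≢z refl)
... | _                 | here refl         | here refl         = ⊥-elim (y≢z refl)
... | there (here refl) | there (here refl) | _                 = ⊥-elim (x≢y refl)
... | there (here refl) | _                 | there (here refl) = ⊥-elim (x≢z refl)
... | _                 | there (here refl) | there (here refl) = ⊥-elim (y≢z refl)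
three-members (a ∷ b ∷ c ∷ rest) _ _ _ _ _ _ = a , b , c , rest , refl

module Infinitude (em : ExcludedMiddle 0ℓ) (s : Sign) {A : Subset}
                  (ppA : ∀ a → A a → IsPrimePower a) (hyp : ShiftHyp s A) where
  open Classical em

  module Smallest (a b c : ℕ) (rest : List ℕ) (increasing : AllPairs _<_ (a ∷ b ∷ c ∷ rest))
                  (inA : All A (a ∷ b ∷ c ∷ rest)) (complete : ∀ x → A x → x ∈ a ∷ b ∷ c ∷ rest) where

    a<b : a < b
    a<b = All.lookup (AllPairs.head increasing) (here refl)
    a<c : a < c
    a<c = All.lookup (AllPairs.head increasing) (there (here refl))
    a<rest : All (a <_) rest
    a<rest = All.tail (All.tail (AllPairs.head increasing))
    b<c : b < c
    b<c = All.head (AllPairs.head (AllPairs.tail increasing))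
    b<rest : All (b <_) rest
    b<rest = All.tail (AllPairs.head (AllPairs.tail increasing))

    ha : IsPrimePower a
    ha = ppA a (All.lookup inA (here refl))
    hb : IsPrimePower b
    hb = ppA b (All.lookup inA (there (here refl)))
    hc : IsPrimePower c
    hc = ppA c (All.lookup inA (there (there (here refl))))
    pa : ℕ
    pa = base ha
    pb : ℕ
    pb = base hb
    2≤a : 2 ≤ a
    2≤a = primePower≥2 ha
    2≤b : 2 ≤ b
    2≤b = primePower≥2 hb
    2≤c : 2 ≤ c
    2≤c = primePower≥2 hc

    R : ℕ
    R = product (c ∷ rest)
    2≤R : 2 ≤ R
    2≤R = ≤-trans 2≤c (m≤m*n c (product rest) {{>-nonZero rest≥1}})
      where
        rest≥1 : 1 ≤ product rest
        rest≥1 = primePowers-product≥1 ppA (All.tail (All.tail (All.tail inA)))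

    outside : ∀ {B q} → InPStar A B → Prime q → q ∣ shift s (product B) →
              ∃[ w ] (w ∈ a ∷ b ∷ c ∷ rest × w ∉ B × q ∣ w)
    outside B∈ pq q∣ with factor-outside s ppA hyp B∈ pq q∣
    ... | w , Aw , w∉B , q∣w = w , complete w Aw , w∉B , q∣w

    only-a : OnlyPrimeFactor pa (shift s (b * R))
    only-a q pq q∣ with outside B∈ pq q∣
      where
        B∈ : InPStar A (b ∷ c ∷ rest)
        B∈ = increasing⇒InPStar (AllPairs.tail increasing) (λ ()) (All.tail inA)
               (All.lookup inA (here refl)) (<-∉ (a<b ∷ a<c ∷ a<rest))
    ... | _ , here refl , _   , q∣a = prime∣primePower⇒≡base ha pq q∣a
    ... | _ , there w∈  , w∉B , _   = ⊥-elim (w∉B w∈)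

    only-b : OnlyPrimeFactor pb (shift s (a * R))
    only-b q pq q∣ with outside B∈ pq q∣
      where
        B∈ : InPStar A (a ∷ c ∷ rest)
        B∈ = increasing⇒InPStar ((a<c ∷ a<rest) ∷ AllPairs.tail (AllPairs.tail increasing)) (λ ())
               (All.head inA ∷ All.tail (All.tail inA)) (All.lookup inA (there (here refl)))
               λ { (here b≡a) → <⇒≢ a<b (sym b≡a) ; (there b∈) → <-∉ (b<c ∷ b<rest) b∈ }
    ... | _ , here refl         , w∉B , _   = ⊥-elim (w∉B (here refl))
    ... | _ , there (here refl) , _   , q∣b = prime∣primePower⇒≡base hb pq q∣b
    ... | _ , there (there w∈)  , w∉B , _   = ⊥-elim (w∉B (there w∈))

    only-ab : ∀ q → Prime q → q ∣ shift s R → q ≡ pa ⊎ q ≡ pb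
    only-ab q pq q∣ with outside B∈ pq q∣
      where
        B∈ : InPStar A (c ∷ rest)
        B∈ = increasing⇒InPStar (AllPairs.tail (AllPairs.tail increasing)) (λ ()) (All.tail (All.tail inA))
               (All.lookup inA (here refl)) (<-∉ (a<c ∷ a<rest))
    ... | _ , here refl                 , _   , q∣a = inj₁ (prime∣primePower⇒≡base ha pq q∣a)
    ... | _ , there (here refl)         , _   , q∣b = inj₂ (prime∣primePower⇒≡base hb pq q∣b)
    ... | _ , there (there w∈)          , w∉B , _   = ⊥-elim (w∉B w∈)

    -- R - ε₀ = pa^u pb^v, where pa^u ∣ b - 1 and pb^v ∣ a - 1.
    shift-R≤ : shift s R ≤ (b ∸ 1) * (a ∸ 1)
    shift-R≤ with two-prime-support pa pb (shift-positive s 2≤R) only-ab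
    ... | u , v , R-ε≡ = begin
      shift s R        ≡⟨ R-ε≡ ⟩
      pa ^ u * pb ^ v  ≤⟨ *-mono-≤ (∣⇒≤ {{>-nonZero 1≤b-1}} paᵘ∣) (∣⇒≤ {{>-nonZero 1≤a-1}} pbᵛ∣) ⟩
      (b ∸ 1) * (a ∸ 1) ∎
      where
        open ≤-Reasoning
        1≤b-1 : 1 ≤ b ∸ 1
        1≤b-1 = ∸-monoˡ-≤ 1 2≤b
        1≤a-1 : 1 ≤ a ∸ 1
        1≤a-1 = ∸-monoˡ-≤ 1 2≤a
        paᵘ∣ : pa ^ u ∣ b ∸ 1
        paᵘ∣ = power∣pred s u (base-prime ha) 2≤b 2≤R only-a
                 (subst (pa ^ u ∣_) (sym R-ε≡) (m∣m*n (pb ^ v)))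
        pbᵛ∣ : pb ^ v ∣ a ∸ 1
        pbᵛ∣ = power∣pred s v (base-prime hb) 2≤a 2≤R only-b
                 (subst (pb ^ v ∣_) (sym R-ε≡) (n∣m*n (pa ^ u)))

    R≤ : R ≤ (b ∸ 1) * (a ∸ 1) + 1
    R≤ = ≤-trans (≤shift+1 s R) (+-monoˡ-≤ 1 shift-R≤)

    -- A fourth element d makes R ≥ cd > b², too large for this bound.
    no-fourth : ∀ {d rest′} → rest ≡ d ∷ rest′ → ⊥
    no-fourth {d} {rest′} refl = product-too-large a<b b<c (All.head b<rest) rest′≥1 R≤
      where
        rest′≥1 : 1 ≤ product rest′
        rest′≥1 = primePowers-product≥1 ppA (All.tail (All.tail (All.tail (All.tail inA))))

    -- With exactly three elements, a ∣ bc - ε₀, b ∣ ac - ε₀ and c ∣ ab - ε₀,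
    -- so abc ∣ ab + bc + ca - ε₀, which is too small.
    not-three : rest ≡ [] → ⊥
    not-three refl = abc-too-large 2≤a a<b b<c c≤ abc≤
      where
        c*1≡c : c * 1 ≡ c
        c*1≡c = *-identityʳ c
        only-a′ : OnlyPrimeFactor pa (shift s (b * c))
        only-a′ = subst (λ n → OnlyPrimeFactor pa (shift s (b * n))) c*1≡c only-a
        only-b′ : OnlyPrimeFactor pb (shift s (a * c))
        only-b′ = subst (λ n → OnlyPrimeFactor pb (shift s (a * n))) c*1≡c only-b
        only-c : OnlyPrimeFactor (base hc) (shift s (a * b))
        only-c q pq q∣ with outside B∈ pq (subst (λ n → q ∣ shift s (a * n)) (sym (*-identityʳ b)) q∣)
          where
            B∈ : InPStar A (a ∷ b ∷ [])
            B∈ = increasing⇒InPStar ((a<b ∷ []) ∷ [] ∷ []) (λ ()) (All.head inA ∷ All.head (All.tail inA) ∷ [])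
                   (All.lookup inA (there (there (here refl))))
                   λ { (here c≡a) → <⇒≢ a<c (sym c≡a) ; (there (here c≡b)) → <⇒≢ b<c (sym c≡b) }
        ... | _ , here refl                 , w∉B , _   = ⊥-elim (w∉B (here refl))
        ... | _ , there (here refl)         , w∉B , _   = ⊥-elim (w∉B (there (here refl)))
        ... | _ , there (there (here refl)) , _   , q∣c = prime∣primePower⇒≡base hc pq q∣c
        c≤ : c ≤ (b ∸ 1) * (a ∸ 1) + 1
        c≤ = subst (_≤ (b ∸ 1) * (a ∸ 1) + 1) c*1≡c R≤
        a∣ : a ∣ shift s (b * c)
        a∣ = primePower-≤⇒∣ ha (shift-positive s (2≤* 2≤b 2≤c)) only-a′ (≤-trans (<⇒≤ a<c) (≤shift-* s c 2≤b))
        b∣ : b ∣ shift s (a * c)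
        b∣ = primePower-≤⇒∣ hb (shift-positive s (2≤* 2≤a 2≤c)) only-b′ (≤-trans (<⇒≤ b<c) (≤shift-* s c 2≤a))
        c∣ : c ∣ shift s (a * b)
        c∣ = primePower-≤⇒∣ hc (shift-positive s (2≤* 2≤a 2≤b)) only-c
               (≤-trans c≤ (≤-trans (pred-product-bound 2≤a (≤-trans (s≤s 2≤a) a<b)) (shift-≥ s (a * b))))
        abc≤ : a * b * c ≤ a * (b + c) + b * c + 1
        abc≤ = ≤-trans (∣⇒≤ {{>-nonZero (shift-positive s 2≤S)}} (pairwise⇒abc∣ s 2≤a 2≤b 2≤c a∣ b∣ c∣))
                       (shift-≤ s (a * (b + c) + b * c))
          where
            2≤S : 2 ≤ a * (b + c) + b * c
            2≤S = ≤-trans (2≤* 2≤b 2≤c) (m≤n+m (b * c) (a * (b + c)))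

    impossible : ⊥
    impossible = by-rest rest refl
      where
        by-rest : ∀ rest′ → rest ≡ rest′ → ⊥
        by-rest []      = not-three
        by-rest (_ ∷ _) = no-fourth

  infinite : AtLeast3 A → Infinite A
  infinite (x , y , z , Ax , Ay , Az , x≢y , x≢z , y≢z) (xs , bounded) with enumerate A xs bounded
  ... | L , increasing , inA , complete
    with three-members L (complete x Ax) (complete y Ay) (complete z Az) x≢y x≢z y≢z
  ... | a , b , c , rest , refl = Smallest.impossible a b c rest increasing inA complete

module FreshSequence (em : ExcludedMiddle 0ℓ) {A : Subset} (inf : Infinite A) where
  open Classical em

  next : List ℕ → ℕ
  next F = proj₁ (fresh inf F)

  next∈A : ∀ F → A (next F)
  next∈A F = proj₁ (proj₂ (fresh inf F))

  next∉ : ∀ F → next F ∉ F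
  next∉ F = proj₂ (proj₂ (fresh inf F))

  -- chosen n = [xₙ₋₁, …, x₀], where xₖ = next (chosen k).
  chosen : ℕ → List ℕ
  chosen zero    = []
  chosen (suc n) = next (chosen n) ∷ chosen n

  -- segment i d = [x_{i+d-1}, …, xᵢ].
  segment : ℕ → ℕ → List ℕ
  segment i zero    = []
  segment i (suc d) = next (chosen (d + i)) ∷ segment i d

  chosen-split : ∀ i d → chosen (d + i) ≡ segment i d ++ chosen i
  chosen-split i zero    = refl
  chosen-split i (suc d) = cong (next (chosen (d + i)) ∷_) (chosen-split i d)

  segment-unique : ∀ i d → Unique (segment i d)
  segment-unique i zero    = []
  segment-unique i (suc d) = All.tabulate distinct ∷ segment-unique i d
    where
      distinct : ∀ {x} → x ∈ segment i d → next (chosen (d + i)) ≢ x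
      distinct {x} x∈ refl = next∉ (chosen (d + i)) (subst (x ∈_) (sym (chosen-split i d)) (∈-++⁺ˡ x∈))

  segment⊆A : ∀ i d → All A (segment i d)
  segment⊆A i zero    = []
  segment⊆A i (suc d) = next∈A _ ∷ segment⊆A i d

  chosen⊆A : ∀ n → All A (chosen n)
  chosen⊆A zero    = []
  chosen⊆A (suc n) = next∈A _ ∷ chosen⊆A n

-- Part (2): for ε₀ = 1, a prime p dividing no element of A yields two partial
-- products ∏ᵢ ≡ ∏ⱼ (mod p), so p ∣ xᵢ⋯xⱼ₋₁ - 1 with {xᵢ, …, xⱼ₋₁} ∈ 𝒫⋆(A).
every-prime-divides : (em : ExcludedMiddle 0ℓ) {A : Subset} → (∀ a → A a → IsPrimePower a) →
                      ShiftHyp plus A → Infinite A → ∀ p → Prime p → ∃[ a ] (A a × p ∣ a)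
every-prime-divides em {A} ppA hyp inf p pp
  with residue-collision p {{prime⇒nonZero pp}} (λ n → product (FreshSequence.chosen em inf n))
... | i , d , same = dne λ none → none (hyp B B∈ p pp (p∣B-1 none))
  where
    open Classical em
    open FreshSequence em inf
    instance
      p≢0 : NonZero p
      p≢0 = prime⇒nonZero pp
    B : List ℕ
    B = segment i (suc d)
    B∈ : InPStar A B
    B∈ = segment-unique i (suc d) , (λ ()) , segment⊆A i (suc d) , next B , next∈A B , next∉ B
    ∏chosen≡ : product (chosen (suc d + i)) ≡ product B * product (chosen i)
    ∏chosen≡ = trans (cong product (chosen-split i (suc d))) (product-++ B (chosen i))
    p∣B-1 : ¬ (∃[ a ] (A a × p ∣ a)) → p ∣ shift plus (product B)
    p∣B-1 none = cancel-mod (product (chosen i)) (product B) pp p∤∏chosen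
                   (primePowers-product≥1 ppA (segment⊆A i (suc d)))
                   (trans (cong (_% p) (sym ∏chosen≡)) same)
      where
        p∤∏chosen : ¬ p ∣ product (chosen i)
        p∤∏chosen = prime∤product (chosen i) pp (All.map (λ {a} Aa p∣a → none (a , Aa , p∣a)) (chosen⊆A i))

module MissingPrime (em : ExcludedMiddle 0ℓ) {A : Subset} (ppA : ∀ a → A a → IsPrimePower a)
                    (hyp : ShiftHyp minus A) (primes : ∀ a → A a → Prime a) (inf : Infinite A)
                    (p : ℕ) (pp : Prime p) (p∉A : ¬ A p) where
  open Classical em

  instance
    p≢0 : NonZero p
    p≢0 = prime⇒nonZero pp

  p∤ : ∀ {a} → A a → ¬ p ∣ a
  p∤ {a} Aa p∣a with prime∣prime⇒≡ pp (primes a Aa) p∣a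
  ... | refl = p∉A Aa

  InfiniteClass : ℕ → Set
  InfiniteClass r = ∀ F → ∃[ a ] (A a × a ∉ F × a % p ≡ r)

  finite-class : ∀ {r} → ¬ InfiniteClass r → ∃[ F ] (∀ a → A a → a % p ≡ r → a ∈ F)
  finite-class finite = dne λ unbounded → finite λ F → dne λ none →
    unbounded (F , λ a Aa a≡r → dne λ a∉F → none (a , Aa , a∉F , a≡r))

  finite-classes-below : ∀ n → ∃[ F ] (∀ a → A a → a % p < n → ¬ InfiniteClass (a % p) → a ∈ F)
  finite-classes-below zero = [] , λ _ _ ()
  finite-classes-below (suc n) with finite-classes-below n | em {InfiniteClass n}
  ... | F , covers | yes infinite-n = F , λ a Aa a<1+n finite →
    [ (λ a<n → covers a Aa a<n finite) , (λ a≡n → ⊥-elim (finite (subst InfiniteClass (sym a≡n) infinite-n))) ]′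
      (m<1+n⇒m<n∨m≡n a<1+n)
  ... | F , covers | no finite-n with finite-class finite-n
  ...   | F′ , covers′ = F ++ F′ , λ a Aa a<1+n finite →
    [ (λ a<n → ∈-++⁺ˡ (covers a Aa a<n finite)) , (λ a≡n → ∈-++⁺ʳ F (covers′ a Aa a≡n)) ]′
      (m<1+n⇒m<n∨m≡n a<1+n)

  e₀ : ℕ
  e₀ = proj₁ (fresh inf [])

  InE : ℕ → Set
  InE x = A x × (x ∈ proj₁ (finite-classes-below p) ⊎ x ≡ e₀)

  E-enumeration : ∃[ L ] (AllPairs _<_ L × All InE L × (∀ x → InE x → x ∈ L))
  E-enumeration = enumerate InE (e₀ ∷ proj₁ (finite-classes-below p)) bounded
    where
      bounded : ∀ x → InE x → x ∈ e₀ ∷ proj₁ (finite-classes-below p)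
      bounded x (_ , inj₁ x∈F) = there x∈F
      bounded x (_ , inj₂ refl) = here refl

  E : List ℕ
  E = proj₁ E-enumeration

  E-unique : Unique E
  E-unique = AllPairs.map <⇒≢ (proj₁ (proj₂ E-enumeration))

  E⊆A : All A E
  E⊆A = All.map proj₁ (proj₁ (proj₂ (proj₂ E-enumeration)))

  E-complete : ∀ {a} → A a → ¬ InfiniteClass (a % p) → a ∈ E
  E-complete {a} Aa finite = proj₂ (proj₂ (proj₂ E-enumeration)) a
    (Aa , inj₁ (proj₂ (finite-classes-below p) a Aa (m%n<n a p) finite))

  e₀∈E : e₀ ∈ E
  e₀∈E = proj₂ (proj₂ (proj₂ E-enumeration)) e₀ (proj₁ (proj₂ (fresh inf [])) , inj₂ refl)

  e : ℕ
  e = product E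

  p∤e : ¬ p ∣ e
  p∤e = prime∤product E pp (All.map p∤ E⊆A)

  -- t k = 1 + e + ⋯ + eᵏ.
  t : ℕ → ℕ
  t zero    = 1
  t (suc k) = e * t k + 1

  t-split : ∀ i d → t (i + suc d) ≡ t i + e ^ suc i * t d
  t-split zero    d = solve 2 (λ e td → e :* td :+ con 1 := con 1 :+ e :* con 1 :* td) refl e (t d)
  t-split (suc i) d = trans (cong (λ n → e * n + 1) (t-split i d))
    (solve 4 (λ e ti eⁱ⁺¹ td → e :* (ti :+ eⁱ⁺¹ :* td) :+ con 1 := (e :* ti :+ con 1) :+ (e :* eⁱ⁺¹) :* td)
           refl e (t i) (e ^ suc i) (t d))

  -- Some t (k + 1) is divisible by p: from tᵢ ≡ t_{i+1+d}, p ∣ e^{i+1} t_d, p ∤ e and t₀ = 1.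
  p∣t : ∃[ k ] p ∣ t (suc k)
  p∣t with residue-collision p t
  ... | i , d , same with euclidsLemma (e ^ suc i) (t d) pp
                            (≡-mod⇒∣ (t i) (e ^ suc i * t d) p
                              (trans (cong (_% p) (sym (t-split i d)))
                                     (trans (cong (λ n → t n % p) (+-comm i (suc d))) same)))
  ...   | inj₁ p∣eⁱ⁺¹ = ⊥-elim (p∤e (prime∣^⇒∣ e (suc i) pp p∣eⁱ⁺¹))
  ...   | inj₂ p∣t_d = positive d p∣t_d
    where
      positive : ∀ d → p ∣ t d → ∃[ k ] p ∣ t (suc k)
      positive zero    p∣1 = ⊥-elim (prime∤1 pp p∣1)
      positive (suc k) p∣t = k , p∣t

  Realisable : ℕ → List ℕ → Set
  Realisable m F = ∃[ B ] (Unique B × All A B × All (_∉ F) B × product B % p ≡ m % p)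

  realisable-cong : ∀ {m n F} → m % p ≡ n % p → Realisable m F → Realisable n F
  realisable-cong m≡n (B , B-unique , B⊆A , B∩F , B≡m) = B , B-unique , B⊆A , B∩F , trans B≡m m≡n

  -- A product of numbers from infinite classes is realisable outside any F:
  -- replace each factor by a fresh element of A in its class.
  realise-product : ∀ fs → All (λ q → InfiniteClass (q % p)) fs → ∀ F → Realisable (product fs) F
  realise-product []       []                 F = [] , [] , [] , [] , refl
  realise-product (q ∷ fs) (q-infinite ∷ fs-infinite) F with realise-product fs fs-infinite F
  ... | B , B-unique , B⊆A , B∩F , B≡ with q-infinite (F ++ B)
  ...   | c , Ac , c∉ , c≡q =
    c ∷ B , All.tabulate c-new ∷ B-unique , Ac ∷ B⊆A , (λ c∈F → c∉ (∈-++⁺ˡ c∈F)) ∷ B∩F ,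
    *-cong-mod c q (product B) (product fs) c≡q B≡
    where
      c-new : ∀ {x} → x ∈ B → c ≢ x
      c-new x∈B refl = c∉ (∈-++⁺ʳ F x∈B)

  adjoin-E : ∀ {m} → Realisable m E →
             ∃[ B ] (InPStar A B × (∀ {x} → x ∈ E → x ∈ B) × (product B + 1) % p ≡ (e * m + 1) % p)
  adjoin-E {m} (B₀ , B₀-unique , B₀⊆A , B₀∩E , B₀≡m) =
    E ++ B₀ , (Unique.++⁺ E-unique B₀-unique disjoint , nonempty (∈-++⁺ˡ e₀∈E) , All.++⁺ E⊆A B₀⊆A , fresh inf (E ++ B₀)) ,
    ∈-++⁺ˡ , trans (cong (λ n → (n + 1) % p) (product-++ E B₀))
                   (+-cong-mod (e * product B₀) (e * m) 1 (*-cong-mod e e (product B₀) m refl B₀≡m))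
    where
      disjoint : ∀ {x} → ¬ (x ∈ E × x ∈ B₀)
      disjoint (x∈E , x∈B₀) = All.lookup B₀∩E x∈B₀ x∈E
      nonempty : ∀ {x : ℕ} {xs} → x ∈ xs → xs ≢ []
      nonempty (here _)  ()
      nonempty (there _) ()

  -- For E ⊆ B ∈ 𝒫⋆(A), every prime factor q of ∏B + 1 lies in A (it divides an element of A,
  -- a prime) and in an infinite class (otherwise q ∈ E ⊆ B would divide ∏B); so ∏B + 1 is realisable.
  successor-realisable : ∀ {B} → InPStar A B → (∀ {x} → x ∈ E → x ∈ B) → ∀ F → Realisable (product B + 1) F
  successor-realisable {B} B∈ E⊆B F with factorise (product B + 1) {{>-nonZero (m≤n+m 1 (product B))}}
  ... | record { factors = fs ; isFactorisation = B+1≡ ; factorsPrime = fs-prime } =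
    realisable-cong (cong (_% p) (sym B+1≡)) (realise-product fs (All.tabulate infinite-class) F)
    where
      infinite-class : ∀ {q} → q ∈ fs → InfiniteClass (q % p)
      infinite-class {q} q∈fs = dne λ finite →
        prime∤1 pq (shift-coprime minus (primePowers-product≥1 ppA (proj₁ (proj₂ (proj₂ B∈))))
                                        (∈⇒∣product (E⊆B (E-complete Aq finite))) q∣B+1)
        where
          pq : Prime q
          pq = All.lookup fs-prime q∈fs
          q∣B+1 : q ∣ product B + 1
          q∣B+1 = subst (q ∣_) (sym B+1≡) (∈⇒∣product q∈fs)
          Aq : A q
          Aq with hyp B B∈ q pq q∣B+1
          ... | a , Aa , q∣a = subst A (sym (prime∣prime⇒≡ pq (primes a Aa) q∣a)) Aa

  t-realisable : ∀ k F → Realisable (t k) F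
  t-realisable zero    F = [] , [] , [] , [] , refl
  t-realisable (suc k) F with adjoin-E (t-realisable k E)
  ... | B , B∈ , E⊆B , B+1≡ = realisable-cong B+1≡ (successor-realisable B∈ E⊆B F)

  impossible : ⊥
  impossible with p∣t
  ... | k , p∣tₖ₊₁ with adjoin-E (t-realisable k E)
  ...   | B , B∈ , _ , B+1≡ with hyp B B∈ p pp (m%n≡0⇒n∣m _ p (trans B+1≡ (n∣m⇒m%n≡0 _ p p∣tₖ₊₁)))
  ...     | a , Aa , p∣a = p∤ Aa p∣a

every-prime-divides-if-plus : ExcludedMiddle 0ℓ → ∀ s {A : Subset} → (∀ a → A a → IsPrimePower a) →
  ShiftHyp s A → Infinite A → value s ≡ 1ℤ → ∀ p → Prime p → ∃[ a ] (A a × p ∣ a)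
every-prime-divides-if-plus em plus  ppA hyp inf _ = every-prime-divides em ppA hyp inf
every-prime-divides-if-plus em minus ppA hyp inf ()

all-primes : ExcludedMiddle 0ℓ → ∀ s {A : Subset} → (∀ a → A a → IsPrimePower a) →
  ShiftHyp s A → Infinite A → (∀ a → A a → Prime a) → ∀ p → Prime p → A p
all-primes em plus {A} ppA hyp inf primes p pp with every-prime-divides em ppA hyp inf p pp
... | a , Aa , p∣a = subst A (sym (prime∣prime⇒≡ pp (primes a Aa) p∣a)) Aa
all-primes em minus ppA hyp inf primes p pp =
  Classical.dne em (MissingPrime.impossible em ppA hyp primes inf p pp)

theorem3 : ExcludedMiddle 0ℓ →
    (ε : ℤ) → (ε ≡ 1ℤ ⊎ ε ≡ -1ℤ) →
    (A : ℕ → Set) → (∀ a → A a → IsPrimePower a) → AtLeast3 A →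
    Hyp ε A →
    Infinite A
    × (ε ≡ 1ℤ → ∀ p → Prime p → ∃[ a ] (A a × p ∣ a))
    × ((∀ a → A a → Prime a) → ∀ p → Prime p → A p)
theorem3 em ε ε≡±1 A ppA three hyp with sign-of ε≡±1
... | s , refl = infinite , every-prime-divides-if-plus em s ppA shiftHyp infinite , all-primes em s ppA shiftHyp infinite
  where
    shiftHyp : ShiftHyp s A
    shiftHyp = Hyp⇒ShiftHyp s ppA hyp
    infinite : Infinite A
    infinite = Infinitude.infinite em s ppA shiftHyp three
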